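{- Let $n\geq 3$ and $i$ be integers and let $(x_1,\ldots,x_n)\in S_i(n)$. Write $\overline{X}_{n-2}=(x_1,\ldots,x_{n-2})$. Then $$\sigma_1(\overline{X}_{n-2})\leq n-i+\frac{i-2}{2^{i-3}}\sigma_{n-2}(\overline{X}_{n-2})$$ and $$\sigma_2(\overline{X}_{n-2})\leq\frac12(n-i)(n-i-1)+\frac{(i-2)(n-3)}{2^{i-3}}\sigma_{n-2}(\overline{X}_{n-2}).$$ In particular, for every $(x_1,\ldots,x_n)\in S(n)$ we have $$\sigma_1(\overline{X}_{n-2})\leq n-3+\sigma_{n-2}(\overline{X}_{n-2})$$ and $$\sigma_2(\overline{X}_{n-2})\leq\frac12(n-3)(n-4)+(n-3)\sigma_{n-2}(\overline{X}_{n-2}).$$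
   Context: $\sigma_k$ denotes the $k$-th elementary symmetric polynomial; $\sigma_{n-2}(\overline{X}_{n-2})=x_1\cdots x_{n-2}$. $S(n)$ is the set of $n$-tuples $(x_1,\ldots,x_n)$ of positive integers with $x_1\leq\cdots\leq x_n$ and $\sigma_2(x_1,\ldots,x_n)=\sigma_n(x_1,\ldots,x_n)$. For $i\in\{0,\ldots,n\}$, $S_i(n)$ is the set of $(x_1,\ldots,x_n)\in S(n)$ with $x_1=\cdots=x_{n-i}=1$ and $2\leq x_{n-i+1}\leq\cdots\leq x_n$. -}

module Defs where

open import Data.Nat as ℕ using (ℕ; zero; suc; _+_; _*_; _∸_; _^_; _≤_)
open import Data.Nat.Properties using (m^n≢0)
open import Data.Integer as ℤ using (ℤ; +_; -[1+_])
open import Data.Rational as ℚ using (ℚ; _/_)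
open import Data.List using (List; []; _∷_; length; take; drop)
open import Data.List.Relation.Unary.All using (All)
open import Data.List.Relation.Unary.Linked using (Linked)
open import Data.Product using (_×_)
open import Relation.Binary.PropositionalEquality using (_≡_)

σ : ℕ → List ℕ → ℕ
σ zero    _        = 1
σ (suc k) []       = 0
σ (suc k) (x ∷ xs) = x * σ k xs + σ (suc k) xs

InS : ℕ → List ℕ → Set
InS n xs = (length xs ≡ n) × All (1 ≤_) xs × Linked _≤_ xs × (σ 2 xs ≡ σ n xs)

InSi : ℕ → ℕ → List ℕ → Set
InSi n i xs = InS n xs × (i ≤ n) × All (_≡ 1) (take (n ∸ i) xs) × All (2 ≤_) (drop (n ∸ i) xs)

Xbar : ℕ → List ℕ → List ℕ
Xbar n xs = take (n ∸ 2) xs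

ℕ→ℚ : ℕ → ℚ
ℕ→ℚ n = + n / 1

ℤ→ℚ : ℤ → ℚ
ℤ→ℚ z = z / 1

divPow2 : ℤ → ℤ → ℚ
divPow2 a (+ k)    = _/_ a (2 ^ k) {{m^n≢0 2 k}}
divPow2 a -[1+ k ] = (a ℤ.* + (2 ^ suc k)) / 1

{-# OPTIONS --safe #-}
-- Write x ∈ S(n) as k ones followed by i entries ≥ 2 (for Sᵢ(n) this is the definition, for
-- S(n) it follows from sortedness). Then X̄ is the k ones followed by the first m = i − 2 large
-- entries ys, so σ₁(X̄) = k + σ₁(ys), 2σ₂(X̄) = k(k − 1) + 2kσ₁(ys) + 2σ₂(ys) and
-- σₙ₋₂(X̄) = ∏ ys. For numbers ≥ 2, induction on m gives 2ᵐ⁻¹σ₁ ≤ m∏ and 2ᵐ⁻¹σ₂ ≤ m(m − 1)∏,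
-- which are the bounds for Sᵢ(n); since m ≤ 2ᵐ⁻¹ they also give σ₁(ys) ≤ ∏ and
-- σ₂(ys) ≤ (m − 1)∏, which yield the bounds for S(n). The equation σ₂ = σₙ is needed only to
-- exclude i ≤ 1, where σ₂ already exceeds the product.
module Submission where

open import Defs
open import Data.Nat using (ℕ; zero; suc; _+_; _*_; _∸_; _^_; _⊓_; _≤_; _<_; z≤n; s≤s; NonZero)
open import Data.Nat.Properties
open import Data.Nat.ListAction using (product)
open import Data.Nat.Tactic.RingSolver using (solve-∀)
open import Data.Integer as ℤ using (+_)
import Data.Integer.Properties as ℤₚ
open import Data.Rational as ℚ using (½; toℚᵘ)
import Data.Rational.Properties as ℚₚ
open import Data.Rational.Unnormalised as ℚᵘ using (mkℚᵘ; *≤*; *≡*)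
import Data.Rational.Unnormalised.Properties as ℚᵘₚ
open import Data.List using (List; []; _∷_; length; take; drop; replicate; _++_)
open import Data.List.Properties using (length-++; length-replicate; length-take; length-drop; take++drop≡id)
open import Data.List.Relation.Unary.All using (All; []; _∷_)
open import Data.List.Relation.Unary.All.Properties using (take⁺)
open import Data.List.Relation.Unary.Linked as Linked using (Linked)
open import Data.List.Relation.Unary.Linked.Properties using (Linked⇒All)
open import Data.Product using (_×_; _,_; proj₁; proj₂; Σ-syntax)
open import Data.Empty using (⊥-elim)
open import Relation.Binary.PropositionalEquality

σ-vanishes : ∀ xs {k} → length xs < k → σ k xs ≡ 0
σ-vanishes []       {suc k} _            = refl
σ-vanishes (x ∷ xs) {suc k} (s≤s |xs|<k)
  rewrite σ-vanishes xs |xs|<k | σ-vanishes xs (m<n⇒m<1+n |xs|<k) | *-zeroʳ x = refl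

σₙ≡product : ∀ xs {n} → length xs ≡ n → σ n xs ≡ product xs
σₙ≡product []       refl = refl
σₙ≡product (x ∷ xs) refl
  rewrite σₙ≡product xs refl | σ-vanishes xs {suc (length xs)} ≤-refl = +-identityʳ (x * product xs)

n*[n∸1]+2*n≡[1+n]*n : ∀ n → n * (n ∸ 1) + 2 * n ≡ suc n * n
n*[n∸1]+2*n≡[1+n]*n zero    = refl
n*[n∸1]+2*n≡[1+n]*n (suc n) = identity n
  where
  identity : ∀ n → suc n * n + 2 * suc n ≡ suc (suc n) * suc n
  identity = solve-∀

σ₁-replicate-1-++ : ∀ k ys → σ 1 (replicate k 1 ++ ys) ≡ k + σ 1 ys
σ₁-replicate-1-++ zero    ys = refl
σ₁-replicate-1-++ (suc k) ys = cong suc (σ₁-replicate-1-++ k ys)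

σ₂-replicate-1-++ : ∀ k ys →
  2 * σ 2 (replicate k 1 ++ ys) ≡ k * (k ∸ 1) + 2 * k * σ 1 ys + 2 * σ 2 ys
σ₂-replicate-1-++ zero    ys = refl
σ₂-replicate-1-++ (suc k) ys = begin
  2 * (1 * σ 1 zs + σ 2 zs)                                      ≡⟨ distrib (σ 1 zs) (σ 2 zs) ⟩
  2 * σ 1 zs + 2 * σ 2 zs                                        ≡⟨ cong₂ (λ a b → 2 * a + b) (σ₁-replicate-1-++ k ys) (σ₂-replicate-1-++ k ys) ⟩
  2 * (k + s₁) + (k * (k ∸ 1) + 2 * k * s₁ + 2 * s₂)              ≡⟨ regroup k (k * (k ∸ 1)) s₁ s₂ ⟩
  (k * (k ∸ 1) + 2 * k) + 2 * suc k * s₁ + 2 * s₂                 ≡⟨ cong (λ a → a + 2 * suc k * s₁ + 2 * s₂) (n*[n∸1]+2*n≡[1+n]*n k) ⟩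
  suc k * k + 2 * suc k * s₁ + 2 * s₂                             ∎
  where
  open ≡-Reasoning
  zs : List ℕ
  zs = replicate k 1 ++ ys
  s₁ s₂ : ℕ
  s₁ = σ 1 ys
  s₂ = σ 2 ys
  distrib : ∀ a b → 2 * (1 * a + b) ≡ 2 * a + 2 * b
  distrib = solve-∀
  regroup : ∀ k w a b → 2 * (k + a) + (w + 2 * k * a + 2 * b) ≡ (w + 2 * k) + 2 * suc k * a + 2 * b
  regroup = solve-∀

σₙ-replicate-1-++ : ∀ k ys {n} → k + length ys ≡ n → σ n (replicate k 1 ++ ys) ≡ product ys
σₙ-replicate-1-++ k ys {n} k+|ys|≡n = trans (σₙ≡product _ |xs|≡n) (product-ones k)
  where
  |xs|≡n : length (replicate k 1 ++ ys) ≡ n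
  |xs|≡n = trans (length-++ (replicate k 1)) (trans (cong (_+ length ys) (length-replicate k)) k+|ys|≡n)
  product-ones : ∀ k → product (replicate k 1 ++ ys) ≡ product ys
  product-ones zero    = refl
  product-ones (suc k) = trans (+-identityʳ _) (product-ones k)

σ₁<σ₂-1∷1∷ : ∀ zs → σ 1 zs < σ 2 (1 ∷ 1 ∷ zs)
σ₁<σ₂-1∷1∷ zs = ≤-trans (m≤m+n (suc (σ 1 zs)) 0) (m≤m+n _ (σ 2 (1 ∷ zs)))

-- Lists of integers ≥ 2

2^length≤product : ∀ {ys} → All (2 ≤_) ys → 2 ^ length ys ≤ product ys
2^length≤product []            = ≤-refl
2^length≤product (2≤y ∷ 2≤ys) = *-mono-≤ 2≤y (2^length≤product 2≤ys)

σ₁-bound : ∀ {ys} → All (2 ≤_) ys → 2 ^ length ys * σ 1 ys ≤ 2 * length ys * product ys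
σ₁-bound []                           = z≤n
σ₁-bound {y ∷ ys} (2≤y ∷ 2≤ys) = begin
  2 * q * (y * 1 + s₁)              ≡⟨ distrib q y s₁ ⟩
  2 * (q * y) + 2 * (q * s₁)        ≤⟨ +-mono-≤ (*-monoʳ-≤ 2 (*-monoˡ-≤ y (2^length≤product 2≤ys)))
                                               (*-monoʳ-≤ 2 (≤-trans (σ₁-bound 2≤ys) 2mP≤ymP)) ⟩
  2 * (P * y) + 2 * (y * (m * P))   ≡⟨ collect P y m ⟩
  2 * suc m * (y * P)               ∎
  where
  open ≤-Reasoning
  m q s₁ P : ℕ
  m = length ys
  q = 2 ^ m
  s₁ = σ 1 ys
  P = product ys
  2mP≤ymP : 2 * m * P ≤ y * (m * P)
  2mP≤ymP = subst (_≤ y * (m * P)) (sym (*-assoc 2 m P)) (*-monoˡ-≤ (m * P) 2≤y)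
  distrib : ∀ q y s → 2 * q * (y * 1 + s) ≡ 2 * (q * y) + 2 * (q * s)
  distrib = solve-∀
  collect : ∀ P y m → 2 * (P * y) + 2 * (y * (m * P)) ≡ 2 * suc m * (y * P)
  collect = solve-∀

σ₂-bound : ∀ {ys} → All (2 ≤_) ys →
  2 ^ length ys * σ 2 ys ≤ 2 * (length ys * (length ys ∸ 1)) * product ys
σ₂-bound []                           = z≤n
σ₂-bound {y ∷ ys} (2≤y ∷ 2≤ys) = begin
  2 * q * (y * s₁ + s₂)                    ≡⟨ distrib q y s₁ s₂ ⟩
  2 * y * (q * s₁) + 2 * (q * s₂)          ≤⟨ +-mono-≤ (*-monoʳ-≤ (2 * y) (σ₁-bound 2≤ys))
                                                      (≤-trans (*-monoʳ-≤ 2 (σ₂-bound 2≤ys)) (*-monoˡ-≤ (2 * w * P) 2≤y)) ⟩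
  2 * y * (2 * m * P) + y * (2 * w * P)    ≡⟨ collect y m w P ⟩
  2 * (y * P) * (w + 2 * m)                ≡⟨ cong (λ a → 2 * (y * P) * a) (n*[n∸1]+2*n≡[1+n]*n m) ⟩
  2 * (y * P) * (suc m * m)                ≡⟨ regroup (suc m * m) y P ⟩
  2 * (suc m * m) * (y * P)                ∎
  where
  open ≤-Reasoning
  m w q s₁ s₂ P : ℕ
  m = length ys
  w = m * (m ∸ 1)
  q = 2 ^ m
  s₁ = σ 1 ys
  s₂ = σ 2 ys
  P = product ys
  distrib : ∀ q y a b → 2 * q * (y * a + b) ≡ 2 * y * (q * a) + 2 * (q * b)
  distrib = solve-∀
  collect : ∀ y m w P → 2 * y * (2 * m * P) + y * (2 * w * P) ≡ 2 * (y * P) * (w + 2 * m)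
  collect = solve-∀
  regroup : ∀ c y P → 2 * (y * P) * c ≡ 2 * c * (y * P)
  regroup = solve-∀

1+n≤2^n : ∀ n → suc n ≤ 2 ^ n
1+n≤2^n zero    = ≤-refl
1+n≤2^n (suc n) = +-mono-≤ (≤-trans (s≤s z≤n) (1+n≤2^n n)) (≤-trans (1+n≤2^n n) (m≤m+n (2 ^ n) 0))

-- Elements of S(n) as a block of ones followed by entries ≥ 2

take-replicate-++ : ∀ {A : Set} k {x : A} m ys → take (k + m) (replicate k x ++ ys) ≡ replicate k x ++ take m ys
take-replicate-++ zero    m ys = refl
take-replicate-++ (suc k) m ys = cong (_ ∷_) (take-replicate-++ k m ys)

Xbar-replicate-1-++ : ∀ k m B → Xbar (k + (2 + m)) (replicate k 1 ++ B) ≡ replicate k 1 ++ take m B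
Xbar-replicate-1-++ k m B = trans (cong (λ j → take j (replicate k 1 ++ B)) (+-∸-assoc k (s≤s (s≤s z≤n))))
                                  (take-replicate-++ k m B)

record OnesThenAtLeastTwo (xs : List ℕ) : Set where
  field
    ones : ℕ
    rest : List ℕ
    xs≡  : xs ≡ replicate ones 1 ++ rest
    2≤rest : All (2 ≤_) rest

All-≡⇒replicate : ∀ {A : Set} {x : A} {xs} → All (_≡ x) xs → xs ≡ replicate (length xs) x
All-≡⇒replicate []           = refl
All-≡⇒replicate (refl ∷ ≡xs) = cong (_ ∷_) (All-≡⇒replicate ≡xs)

InSi⇒OnesThenAtLeastTwo : ∀ {n i xs} → InSi n i xs →
  Σ[ d ∈ OnesThenAtLeastTwo xs ] length (OnesThenAtLeastTwo.rest d) ≡ i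
InSi⇒OnesThenAtLeastTwo {n} {i} {xs} ((|xs|≡n , _) , i≤n , ones≡1 , 2≤rest) =
  record { ones = k ; rest = drop k xs ; xs≡ = xs≡ ; 2≤rest = 2≤rest } , |rest|≡i
  where
  k : ℕ
  k = n ∸ i
  |take|≡k : length (take k xs) ≡ k
  |take|≡k = trans (length-take k xs) (trans (cong (k ⊓_) |xs|≡n) (m≤n⇒m⊓n≡m (m∸n≤m n i)))
  xs≡ : xs ≡ replicate k 1 ++ drop k xs
  xs≡ = trans (sym (take++drop≡id k xs))
              (cong (_++ drop k xs) (trans (All-≡⇒replicate ones≡1) (cong (λ j → replicate j 1) |take|≡k)))
  |rest|≡i : length (drop k xs) ≡ i
  |rest|≡i = trans (length-drop k xs) (trans (cong (_∸ k) |xs|≡n) (m∸[m∸n]≡n i≤n))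

sorted⇒OnesThenAtLeastTwo : ∀ {xs} → All (1 ≤_) xs → Linked _≤_ xs → OnesThenAtLeastTwo xs
sorted⇒OnesThenAtLeastTwo {[]} _ _ =
  record { ones = 0 ; rest = [] ; xs≡ = refl ; 2≤rest = [] }
sorted⇒OnesThenAtLeastTwo {0 ∷ _} (() ∷ _) _
sorted⇒OnesThenAtLeastTwo {1 ∷ xs} (_ ∷ 1≤xs) sorted =
  let d = sorted⇒OnesThenAtLeastTwo 1≤xs (Linked.tail sorted)
      open OnesThenAtLeastTwo d
  in record { ones = suc ones ; rest = rest ; xs≡ = cong (1 ∷_) xs≡ ; 2≤rest = 2≤rest }
sorted⇒OnesThenAtLeastTwo {x@(suc (suc _)) ∷ xs} _ sorted =
  record { ones = 0 ; rest = x ∷ xs ; xs≡ = refl ; 2≤rest = Linked⇒All ≤-trans (s≤s (s≤s z≤n)) sorted }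

product<σ₂ : ∀ k B → length B ≤ 1 → 3 ≤ k + length B → product B < σ 2 (replicate k 1 ++ B)
product<σ₂ (suc (suc (suc k))) []      _ _ = ≤-<-trans (s≤s z≤n) (σ₁<σ₂-1∷1∷ (replicate (suc k) 1 ++ []))
product<σ₂ (suc (suc k))       (x ∷ []) _ _ = ≤-<-trans x≤σ₁ (σ₁<σ₂-1∷1∷ (replicate k 1 ++ x ∷ []))
  where
  x≤σ₁ : x * 1 ≤ σ 1 (replicate k 1 ++ x ∷ [])
  x≤σ₁ = subst (x * 1 ≤_) (sym (σ₁-replicate-1-++ k (x ∷ []))) (≤-trans (m≤m+n (x * 1) 0) (m≤n+m _ k))
product<σ₂ (suc zero)       []          _        (s≤s ())
product<σ₂ (suc (suc zero)) []          _        (s≤s (s≤s ()))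
product<σ₂ zero             (_ ∷ [])    _        (s≤s ())
product<σ₂ (suc zero)       (_ ∷ [])    _        (s≤s (s≤s ()))
product<σ₂ _                (_ ∷ _ ∷ _) (s≤s ()) _

σ₂≢σₙ : ∀ k B → length B ≤ 1 → 3 ≤ k + length B →
  σ 2 (replicate k 1 ++ B) ≢ σ (k + length B) (replicate k 1 ++ B)
σ₂≢σₙ k B |B|≤1 3≤n σ₂≡σₙ =
  <-irrefl (sym (trans σ₂≡σₙ (σₙ-replicate-1-++ k B refl))) (product<σ₂ k B |B|≤1 3≤n)

-- Clearing denominators in ℚ

-- ℚ normalises by gcd, so inequalities between explicit fractions are checked in ℚᵘ, where they
-- are inequalities between cross-multiplied numerators.
toℚᵘ-/ : ∀ i d → toℚᵘ (i ℚ./ suc d) ℚᵘ.≃ mkℚᵘ i d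
toℚᵘ-/ i d = ℚₚ.toℚᵘ-fromℚᵘ (mkℚᵘ i d)

ℕ→ℚ-≤-/+/* : ∀ {L a c P} d₁ d₂ .{{_ : NonZero d₁}} .{{_ : NonZero d₂}} →
  L * (d₁ * d₂) ≤ a * d₂ + c * P * d₁ →
  ℕ→ℚ L ℚ.≤ + a ℚ./ d₁ ℚ.+ (+ c ℚ./ d₂) ℚ.* ℕ→ℚ P
ℕ→ℚ-≤-/+/* {L} {a} {c} {P} d₁@(suc p) d₂@(suc q) L*d≤ =
  ℚₚ.toℚᵘ-cancel-≤ (ℚᵘₚ.≤-respˡ-≃ (ℚᵘₚ.≃-sym (toℚᵘ-/ (+ L) 0)) (ℚᵘₚ.≤-respʳ-≃ (ℚᵘₚ.≃-sym rhs≃) (*≤* ineq)))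
  where
  rhs≃ : toℚᵘ (+ a ℚ./ d₁ ℚ.+ (+ c ℚ./ d₂) ℚ.* ℕ→ℚ P) ℚᵘ.≃ mkℚᵘ (+ a) p ℚᵘ.+ mkℚᵘ (+ c) q ℚᵘ.* mkℚᵘ (+ P) 0
  rhs≃ = ℚᵘₚ.≃-trans (ℚₚ.toℚᵘ-homo-+ (+ a ℚ./ d₁) ((+ c ℚ./ d₂) ℚ.* ℕ→ℚ P))
           (ℚᵘₚ.+-cong (toℚᵘ-/ (+ a) p)
             (ℚᵘₚ.≃-trans (ℚₚ.toℚᵘ-homo-* (+ c ℚ./ d₂) (ℕ→ℚ P)) (ℚᵘₚ.*-cong (toℚᵘ-/ (+ c) q) (toℚᵘ-/ (+ P) 0))))
  num≡ : + (a * (d₂ * 1) + c * P * d₁) ≡ + a ℤ.* + (d₂ * 1) ℤ.+ + c ℤ.* + P ℤ.* + d₁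
  num≡ = trans (ℤₚ.pos-+ (a * (d₂ * 1)) (c * P * d₁))
               (cong₂ ℤ._+_ (ℤₚ.pos-* a _) (trans (ℤₚ.pos-* (c * P) d₁) (cong (ℤ._* + d₁) (ℤₚ.pos-* c P))))
  ineq : + L ℤ.* + (d₁ * (d₂ * 1)) ℤ.≤ (+ a ℤ.* + (d₂ * 1) ℤ.+ + c ℤ.* + P ℤ.* + d₁) ℤ.* + 1
  ineq = subst₂ ℤ._≤_ (ℤₚ.pos-* L _) (trans (ℤₚ.pos-* (a * (d₂ * 1) + c * P * d₁) 1) (cong (ℤ._* + 1) num≡))
           (ℤ.+≤+ (subst₂ _≤_ (cong (λ d → L * (d₁ * d)) (sym (*-identityʳ d₂)))
                              (trans (cong (λ d → a * d + c * P * d₁) (sym (*-identityʳ d₂)))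
                                     (sym (*-identityʳ (a * (d₂ * 1) + c * P * d₁))))
                              L*d≤))

-- Integer numerators are taken up to ≡, so that callers can pass the differences of the
-- statement, such as + n ℤ.- + i, which do not reduce to a numeral.
ℕ→ℚ-≤-+/* : ∀ {L a c P x y} d .{{_ : NonZero d}} → x ≡ + a → y ≡ + c →
  d * L ≤ d * a + c * P → ℕ→ℚ L ℚ.≤ ℤ→ℚ x ℚ.+ (y ℚ./ d) ℚ.* ℕ→ℚ P
ℕ→ℚ-≤-+/* {L} {a} {c} {P} d refl refl dL≤ = ℕ→ℚ-≤-/+/* {L} {a} {c} {P} 1 d (subst₂ _≤_ (lhs L d) (rhs a c P d) dL≤)
  where
  lhs : ∀ L d → d * L ≡ L * (1 * d)
  lhs = solve-∀
  rhs : ∀ a c P d → d * a + c * P ≡ a * d + c * P * 1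
  rhs = solve-∀

ℕ→ℚ-≤-+ : ∀ {L a P x} → x ≡ + a → L ≤ a + P → ℕ→ℚ L ℚ.≤ ℤ→ℚ x ℚ.+ ℕ→ℚ P
ℕ→ℚ-≤-+ {L} {a} {P} {x} x≡a L≤ =
  subst (λ p → ℕ→ℚ L ℚ.≤ ℤ→ℚ x ℚ.+ p) (ℚₚ.*-identityˡ (ℕ→ℚ P))
    (ℕ→ℚ-≤-+/* {L} {a} {1} {P} 1 x≡a refl
      (subst₂ _≤_ (sym (+-identityʳ L)) (sym (cong₂ _+_ (+-identityʳ a) (+-identityʳ P))) L≤))

½*t*[t-1]≡t*[t∸1]/2 : ∀ t → ½ ℚ.* ℤ→ℚ (+ t) ℚ.* ℤ→ℚ (+ t ℤ.- + 1) ≡ + (t * (t ∸ 1)) ℚ./ 2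
½*t*[t-1]≡t*[t∸1]/2 zero      = refl
½*t*[t-1]≡t*[t∸1]/2 t@(suc u) =
  ℚₚ.toℚᵘ-injective (ℚᵘₚ.≃-trans lhs≃ (ℚᵘₚ.≃-trans (*≡* num≡) (ℚᵘₚ.≃-sym (toℚᵘ-/ (+ (t * u)) 1))))
  where
  lhs≃ : toℚᵘ (½ ℚ.* ℕ→ℚ t ℚ.* ℕ→ℚ u) ℚᵘ.≃ mkℚᵘ (+ 1) 1 ℚᵘ.* mkℚᵘ (+ t) 0 ℚᵘ.* mkℚᵘ (+ u) 0
  lhs≃ = ℚᵘₚ.≃-trans (ℚₚ.toℚᵘ-homo-* (½ ℚ.* ℕ→ℚ t) (ℕ→ℚ u))
           (ℚᵘₚ.*-cong (ℚᵘₚ.≃-trans (ℚₚ.toℚᵘ-homo-* ½ (ℕ→ℚ t)) (ℚᵘₚ.*-cong (ℚᵘₚ.≃-refl {mkℚᵘ (+ 1) 1}) (toℚᵘ-/ (+ t) 0)))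
                       (toℚᵘ-/ (+ u) 0))
  num≡ : (+ 1 ℤ.* + t) ℤ.* + u ℤ.* + 2 ≡ + (t * u) ℤ.* + 2
  num≡ = cong (ℤ._* + 2) (trans (cong (ℤ._* + u) (ℤₚ.*-identityˡ (+ t))) (sym (ℤₚ.pos-* t u)))

ℕ→ℚ-≤-½t[t-1]+/* : ∀ {L c P x y z} t d .{{_ : NonZero d}} → x ≡ + t → y ≡ + t ℤ.- + 1 → z ≡ + c →
  2 * d * L ≤ d * (t * (t ∸ 1)) + 2 * c * P →
  ℕ→ℚ L ℚ.≤ ½ ℚ.* ℤ→ℚ x ℚ.* ℤ→ℚ y ℚ.+ (z ℚ./ d) ℚ.* ℕ→ℚ P
ℕ→ℚ-≤-½t[t-1]+/* {L} {c} {P} t d refl refl refl 2dL≤ =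
  subst (λ p → ℕ→ℚ L ℚ.≤ p ℚ.+ (+ c ℚ./ d) ℚ.* ℕ→ℚ P) (sym (½*t*[t-1]≡t*[t∸1]/2 t))
    (ℕ→ℚ-≤-/+/* {L} {t * (t ∸ 1)} {c} {P} 2 d (subst₂ _≤_ (lhs L d) (rhs (t * (t ∸ 1)) c P d) 2dL≤))
  where
  lhs : ∀ L d → 2 * d * L ≡ L * (2 * d)
  lhs = solve-∀
  rhs : ∀ w c P d → d * w + 2 * c * P ≡ w * d + c * P * 2
  rhs = solve-∀

+[m+n]-+[m+o]≡+n-+o : ∀ m n o → + (m + n) ℤ.- + (m + o) ≡ + n ℤ.- + o
+[m+n]-+[m+o]≡+n-+o m n o = begin
  + (m + n) ℤ.- + (m + o) ≡⟨ ℤₚ.[+m]-[+n]≡m⊖n (m + n) (m + o) ⟩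
  (m + n) ℤ.⊖ (m + o)     ≡⟨ ℤₚ.+-cancelˡ-⊖ m n o ⟩
  n ℤ.⊖ o                 ≡⟨ ℤₚ.[+m]-[+n]≡m⊖n n o ⟨
  + n ℤ.- + o             ∎
  where open ≡-Reasoning

+[m+n]-+n≡+m : ∀ m n → + (m + n) ℤ.- + n ≡ + m
+[m+n]-+n≡+m m n = begin
  + (m + n) ℤ.- + n ≡⟨ ℤₚ.[+m]-[+n]≡m⊖n (m + n) n ⟩
  (m + n) ℤ.⊖ n     ≡⟨ ℤₚ.⊖-≥ (m≤n+m n m) ⟩
  + (m + n ∸ n)     ≡⟨ cong +_ (m+n∸n≡m m n) ⟩
  + m               ∎
  where open ≡-Reasoning

Bounds-Sᵢ : ℕ → ℕ → List ℕ → Set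
Bounds-Sᵢ n i X =
    (ℕ→ℚ (σ 1 X) ℚ.≤ ℤ→ℚ (+ n ℤ.- + i) ℚ.+ divPow2 (+ i ℤ.- + 2) (+ i ℤ.- + 3) ℚ.* ℕ→ℚ (σ (n ∸ 2) X))
  × (ℕ→ℚ (σ 2 X) ℚ.≤ ½ ℚ.* ℤ→ℚ (+ n ℤ.- + i) ℚ.* ℤ→ℚ (+ n ℤ.- + i ℤ.- + 1)
                      ℚ.+ divPow2 ((+ i ℤ.- + 2) ℤ.* (+ n ℤ.- + 3)) (+ i ℤ.- + 3) ℚ.* ℕ→ℚ (σ (n ∸ 2) X))

Bounds-S : ℕ → List ℕ → Set
Bounds-S n X =
    (ℕ→ℚ (σ 1 X) ℚ.≤ ℤ→ℚ (+ n ℤ.- + 3) ℚ.+ ℕ→ℚ (σ (n ∸ 2) X))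
  × (ℕ→ℚ (σ 2 X) ℚ.≤ ½ ℚ.* ℤ→ℚ (+ n ℤ.- + 3) ℚ.* ℤ→ℚ (+ n ℤ.- + 4) ℚ.+ ℤ→ℚ (+ n ℤ.- + 3) ℚ.* ℕ→ℚ (σ (n ∸ 2) X))

Bounds : ℕ → ℕ → List ℕ → Set
Bounds n i X = Bounds-Sᵢ n i X × Bounds-S n X

-- Here i − 3 = −1, and the coefficient divPow2 0 (−1) reduces to 0 / 1.
bounds-i≡2 : ∀ k → Bounds (3 + k) 2 (replicate (suc k) 1 ++ [])
bounds-i≡2 k =
    ( ℕ→ℚ-≤-+/* {σ 1 X} {suc k} {0} {P} 1 refl refl Sᵢ-bound₁
    , ℕ→ℚ-≤-½t[t-1]+/* {σ 2 X} {0} {P} (suc k) 1 refl refl refl Sᵢ-bound₂ )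
  , ( ℕ→ℚ-≤-+ {σ 1 X} {k} {P} refl S-bound₁
    , ℕ→ℚ-≤-½t[t-1]+/* {σ 2 X} {k} {P} k 1 refl (+[m+n]-+[m+o]≡+n-+o 3 k 1) refl S-bound₂ )
  where
  open ≡-Reasoning
  X : List ℕ
  X = replicate (suc k) 1 ++ []
  P : ℕ
  P = σ (suc k) X
  P≡1 : P ≡ 1
  P≡1 = σₙ-replicate-1-++ (suc k) [] (+-identityʳ (suc k))
  σ₁X≡1+k : σ 1 X ≡ suc k + 0
  σ₁X≡1+k = σ₁-replicate-1-++ (suc k) []
  2σ₂X≡[1+k]*k : 2 * σ 2 X ≡ suc k * k
  2σ₂X≡[1+k]*k = trans (σ₂-replicate-1-++ (suc k) []) (drop-zeros k)
    where
    drop-zeros : ∀ k → suc k * k + 2 * suc k * 0 + 2 * 0 ≡ suc k * k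
    drop-zeros = solve-∀

  Sᵢ-bound₁ : 1 * σ 1 X ≤ 1 * suc k + 0 * P
  Sᵢ-bound₁ = ≤-reflexive (cong (_+ 0) σ₁X≡1+k)
  Sᵢ-bound₂ : 2 * 1 * σ 2 X ≤ 1 * (suc k * k) + 2 * 0 * P
  Sᵢ-bound₂ = ≤-reflexive (trans 2σ₂X≡[1+k]*k (sym (trans (+-identityʳ _) (+-identityʳ _))))
  S-bound₁ : σ 1 X ≤ k + P
  S-bound₁ = ≤-reflexive (begin
    σ 1 X      ≡⟨ σ₁X≡1+k ⟩
    suc k + 0  ≡⟨ +-identityʳ (suc k) ⟩
    suc k      ≡⟨ +-comm 1 k ⟩
    k + 1      ≡⟨ cong (λ p → k + p) P≡1 ⟨
    k + P      ∎)
  S-bound₂ : 2 * 1 * σ 2 X ≤ 1 * (k * (k ∸ 1)) + 2 * k * P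
  S-bound₂ = ≤-reflexive (begin
    2 * σ 2 X                   ≡⟨ 2σ₂X≡[1+k]*k ⟩
    suc k * k                   ≡⟨ n*[n∸1]+2*n≡[1+n]*n k ⟨
    k * (k ∸ 1) + 2 * k         ≡⟨ pad (k * (k ∸ 1)) k ⟩
    1 * (k * (k ∸ 1)) + 2 * k * 1 ≡⟨ cong (λ p → 1 * (k * (k ∸ 1)) + 2 * k * p) P≡1 ⟨
    1 * (k * (k ∸ 1)) + 2 * k * P ∎)
    where
    pad : ∀ w k → w + 2 * k ≡ 1 * w + 2 * k * 1
    pad = solve-∀

bounds-i≥3 : ∀ k e ys → All (2 ≤_) ys → length ys ≡ suc e → Bounds (3 + (k + e)) (3 + e) (replicate k 1 ++ ys)
bounds-i≥3 k e ys 2≤ys |ys|≡1+e =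
    ( ℕ→ℚ-≤-+/* {σ 1 X} {k} {suc e} {P} q n-i≡k refl Sᵢ-bound₁
    , ℕ→ℚ-≤-½t[t-1]+/* {σ 2 X} {suc e * t} {P} k q n-i≡k (cong (ℤ._- + 1) n-i≡k) (sym (ℤₚ.pos-* (suc e) t)) Sᵢ-bound₂ )
  , ( ℕ→ℚ-≤-+ {σ 1 X} {t} {P} refl S-bound₁
    , ℕ→ℚ-≤-½t[t-1]+/* {σ 2 X} {t} {P} t 1 refl (+[m+n]-+[m+o]≡+n-+o 3 t 1) refl S-bound₂ )
  where
  X : List ℕ
  X = replicate k 1 ++ ys
  t q w s₁ s₂ P : ℕ
  t = k + e
  q = 2 ^ e
  w = k * (k ∸ 1)
  s₁ = σ 1 ys
  s₂ = σ 2 ys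
  P = σ (suc t) X
  instance
    q≢0 : NonZero q
    q≢0 = m^n≢0 2 e
  P≡Πys : P ≡ product ys
  P≡Πys = σₙ-replicate-1-++ k ys (trans (cong (λ m → k + m) |ys|≡1+e) (+-suc k e))
  n-i≡k : + (3 + t) ℤ.- + (3 + e) ≡ + k
  n-i≡k = trans (+[m+n]-+[m+o]≡+n-+o 3 t e) (+[m+n]-+n≡+m k e)
  halve : ∀ {a b c d} → 2 * a * b ≤ 2 * c * d → a * b ≤ c * d
  halve {a} {b} {c} {d} h = *-cancelˡ-≤ 2 (subst₂ _≤_ (*-assoc 2 a b) (*-assoc 2 c d) h)
  qs₁≤ : q * s₁ ≤ suc e * P
  qs₁≤ = halve {q} {s₁} {suc e} {P} (subst₂ (λ m Π → 2 ^ m * s₁ ≤ 2 * m * Π) |ys|≡1+e (sym P≡Πys) (σ₁-bound 2≤ys))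
  qs₂≤ : q * s₂ ≤ suc e * e * P
  qs₂≤ = halve {q} {s₂} {suc e * e} {P} (subst₂ (λ m Π → 2 ^ m * s₂ ≤ 2 * (m * (m ∸ 1)) * Π) |ys|≡1+e (sym P≡Πys) (σ₂-bound 2≤ys))
  s₁≤P : s₁ ≤ P
  s₁≤P = *-cancelˡ-≤ q (≤-trans qs₁≤ (*-monoˡ-≤ P (1+n≤2^n e)))
  s₂≤eP : s₂ ≤ e * P
  s₂≤eP = *-cancelˡ-≤ q (≤-trans qs₂≤ (subst (_≤ q * (e * P)) (sym (*-assoc (suc e) e P)) (*-monoˡ-≤ (e * P) (1+n≤2^n e))))

  Sᵢ-bound₁ : q * σ 1 X ≤ q * k + suc e * P
  Sᵢ-bound₁ = begin
    q * σ 1 X        ≡⟨ cong (q *_) (σ₁-replicate-1-++ k ys) ⟩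
    q * (k + s₁)     ≡⟨ *-distribˡ-+ q k s₁ ⟩
    q * k + q * s₁   ≤⟨ +-monoʳ-≤ (q * k) qs₁≤ ⟩
    q * k + suc e * P ∎
    where open ≤-Reasoning
  Sᵢ-bound₂ : 2 * q * σ 2 X ≤ q * w + 2 * (suc e * t) * P
  Sᵢ-bound₂ = begin
    2 * q * σ 2 X                                          ≡⟨ *-comm-assoc q (σ 2 X) ⟩
    q * (2 * σ 2 X)                                        ≡⟨ cong (q *_) (σ₂-replicate-1-++ k ys) ⟩
    q * (w + 2 * k * s₁ + 2 * s₂)                          ≡⟨ distrib q w k s₁ s₂ ⟩
    q * w + 2 * k * (q * s₁) + 2 * (q * s₂)                ≤⟨ +-mono-≤ (+-monoʳ-≤ (q * w) (*-monoʳ-≤ (2 * k) qs₁≤)) (*-monoʳ-≤ 2 qs₂≤) ⟩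
    q * w + 2 * k * (suc e * P) + 2 * (suc e * e * P)      ≡⟨ collect q w k e P ⟩
    q * w + 2 * (suc e * (k + e)) * P                      ∎
    where
    open ≤-Reasoning
    *-comm-assoc : ∀ q L → 2 * q * L ≡ q * (2 * L)
    *-comm-assoc = solve-∀
    distrib : ∀ q w k a b → q * (w + 2 * k * a + 2 * b) ≡ q * w + 2 * k * (q * a) + 2 * (q * b)
    distrib = solve-∀
    collect : ∀ q w k e P → q * w + 2 * k * (suc e * P) + 2 * (suc e * e * P) ≡ q * w + 2 * (suc e * (k + e)) * P
    collect = solve-∀
  S-bound₁ : σ 1 X ≤ t + P
  S-bound₁ = begin
    σ 1 X       ≡⟨ σ₁-replicate-1-++ k ys ⟩
    k + s₁      ≤⟨ +-mono-≤ (m≤m+n k e) s₁≤P ⟩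
    t + P       ∎
    where open ≤-Reasoning
  S-bound₂ : 2 * 1 * σ 2 X ≤ 1 * (t * (t ∸ 1)) + 2 * t * P
  S-bound₂ = begin
    2 * σ 2 X                                  ≡⟨ σ₂-replicate-1-++ k ys ⟩
    w + 2 * k * s₁ + 2 * s₂                    ≤⟨ +-mono-≤ (+-mono-≤ w≤ (*-monoʳ-≤ (2 * k) s₁≤P)) (*-monoʳ-≤ 2 s₂≤eP) ⟩
    t * (t ∸ 1) + 2 * k * P + 2 * (e * P)       ≡⟨ collect (t * (t ∸ 1)) k e P ⟩
    1 * (t * (t ∸ 1)) + 2 * (k + e) * P        ∎
    where
    open ≤-Reasoning
    w≤ : w ≤ t * (t ∸ 1)
    w≤ = *-mono-≤ (m≤m+n k e) (∸-monoˡ-≤ 1 (m≤m+n k e))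
    collect : ∀ v k e P → v + 2 * k * P + 2 * (e * P) ≡ 1 * v + 2 * (k + e) * P
    collect = solve-∀

bounds-replicate-1-++ : ∀ {n} k B → All (2 ≤_) B → 3 ≤ n → n ≡ k + length B →
  σ 2 (replicate k 1 ++ B) ≡ σ n (replicate k 1 ++ B) → Bounds n (length B) (Xbar n (replicate k 1 ++ B))
bounds-replicate-1-++ k B@[]       _ 3≤n refl σ₂≡σₙ = ⊥-elim (σ₂≢σₙ k B z≤n 3≤n σ₂≡σₙ)
bounds-replicate-1-++ k B@(_ ∷ []) _ 3≤n refl σ₂≡σₙ = ⊥-elim (σ₂≢σₙ k B ≤-refl 3≤n σ₂≡σₙ)
bounds-replicate-1-++ zero (_ ∷ _ ∷ []) _ (s≤s (s≤s ())) refl _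
bounds-replicate-1-++ (suc j) B@(_ ∷ _ ∷ []) _ _ refl _ =
  subst₂ (λ n X → Bounds n 2 X) (cong suc (+-comm 2 j)) (sym (Xbar-replicate-1-++ (suc j) 0 B)) (bounds-i≡2 j)
bounds-replicate-1-++ k B@(_ ∷ _ ∷ _ ∷ B′) 2≤B _ refl _ =
  subst₂ (λ n X → Bounds n (3 + e) X) (reassoc k e) (sym (Xbar-replicate-1-++ k (suc e) B))
    (bounds-i≥3 k e (take (suc e) B) (take⁺ (suc e) 2≤B) |ys|≡1+e)
  where
  e : ℕ
  e = length B′
  |ys|≡1+e : length (take (suc e) B) ≡ suc e
  |ys|≡1+e = trans (length-take (suc e) B) (m≤n⇒m⊓n≡m (s≤s (m≤n+m e 2)))
  reassoc : ∀ k e → 3 + (k + e) ≡ k + (3 + e)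
  reassoc = solve-∀

InS⇒Bounds : ∀ {n xs} → 3 ≤ n → InS n xs → (d : OnesThenAtLeastTwo xs) →
  Bounds n (length (OnesThenAtLeastTwo.rest d)) (Xbar n xs)
InS⇒Bounds {n} 3≤n (|xs|≡n , _ , _ , σ₂≡σₙ) record { ones = k ; rest = B ; xs≡ = refl ; 2≤rest = 2≤B } =
  bounds-replicate-1-++ k B 2≤B 3≤n n≡k+|B| σ₂≡σₙ
  where
  n≡k+|B| : n ≡ k + length B
  n≡k+|B| = trans (sym |xs|≡n) (trans (length-++ (replicate k 1)) (cong (_+ length B) (length-replicate k)))

corollary2p9 : (n : ℕ) → 3 ≤ n →
      ((i : ℕ) (xs : List ℕ) → InSi n i xs →
        (ℕ→ℚ (σ 1 (Xbar n xs)) ℚ.≤ ℤ→ℚ (+ n ℤ.- + i) ℚ.+ divPow2 (+ i ℤ.- + 2) (+ i ℤ.- + 3) ℚ.* ℕ→ℚ (σ (n Data.Nat.∸ 2) (Xbar n xs)))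
        × (ℕ→ℚ (σ 2 (Xbar n xs)) ℚ.≤ ½ ℚ.* ℤ→ℚ (+ n ℤ.- + i) ℚ.* ℤ→ℚ (+ n ℤ.- + i ℤ.- + 1) ℚ.+ divPow2 ((+ i ℤ.- + 2) ℤ.* (+ n ℤ.- + 3)) (+ i ℤ.- + 3) ℚ.* ℕ→ℚ (σ (n Data.Nat.∸ 2) (Xbar n xs))))
    × ((xs : List ℕ) → InS n xs →
        (ℕ→ℚ (σ 1 (Xbar n xs)) ℚ.≤ ℤ→ℚ (+ n ℤ.- + 3) ℚ.+ ℕ→ℚ (σ (n Data.Nat.∸ 2) (Xbar n xs)))
        × (ℕ→ℚ (σ 2 (Xbar n xs)) ℚ.≤ ½ ℚ.* ℤ→ℚ (+ n ℤ.- + 3) ℚ.* ℤ→ℚ (+ n ℤ.- + 4) ℚ.+ ℤ→ℚ (+ n ℤ.- + 3) ℚ.* ℕ→ℚ (σ (n Data.Nat.∸ 2) (Xbar n xs))))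
corollary2p9 n 3≤n = Sᵢ-bounds , S-bounds
  where
  Sᵢ-bounds : ∀ i xs → InSi n i xs → Bounds-Sᵢ n i (Xbar n xs)
  Sᵢ-bounds i xs xs∈Sᵢ with InSi⇒OnesThenAtLeastTwo xs∈Sᵢ
  ... | d , |rest|≡i = subst (λ j → Bounds-Sᵢ n j (Xbar n xs)) |rest|≡i (proj₁ (InS⇒Bounds 3≤n (proj₁ xs∈Sᵢ) d))
  S-bounds : ∀ xs → InS n xs → Bounds-S n (Xbar n xs)
  S-bounds xs xs∈S@(_ , 1≤xs , sorted , _) = proj₂ (InS⇒Bounds 3≤n xs∈S (sorted⇒OnesThenAtLeastTwo 1≤xs sorted))
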